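{- Let $G$ be a finite graph on $n$ vertices, and let $k \geq \chi_g(G)+1$. For any proper $k$-coloring $\alpha$ of $G$ and any optimal coloring $\beta$ of $G$, the distance between $\alpha$ and $\beta$ in $R_k(G)$ satisfies $d(\alpha,\beta)\leq 2 \cdot \chi(G) \cdot n$.
   Context: A (proper) $k$-coloring of $G=(V,E)$ is a map $f:V\to\{1,\dots,k\}$ with $f(x)\neq f(y)$ for every edge $xy$. Two $k$-colorings are adjacent if they differ on exactly one vertex; $R_k(G)$ is the graph on proper $k$-colorings with this adjacency, and $d(\alpha,\beta)$ is the distance in $R_k(G)$. For an ordering $x_1,\dots,x_n$ of $V$, the greedy coloring assigns to each $x_i$ in turn the smallest positive integer not used on $N(x_i)\cap\{x_1,\dots,x_{i-1}\}$. The grundy number $\chi_g(G)$ is the maximum over all orderings of the number of colors used by the greedy coloring. $\chi(G)$ is the chromatic number. An optimal coloring of $G$ is a greedy coloring of $G$ (with respect to some ordering of $V$) that uses exactly $\chi(G)$ colors, i.e. the colors $1,\dots,\chi(G)$. -}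

module Defs where

open import Data.Nat using (ℕ; zero; suc; _≤_; _<_)
open import Data.Fin using (Fin) renaming (_<_ to _<ᶠ_)
open import Data.Fin.Permutation using (Permutation′; _⟨$⟩ʳ_)
open import Data.Product using (Σ; ∃; ∃-syntax; _×_; _,_)
open import Relation.Binary.PropositionalEquality using (_≡_; _≢_)
open import Relation.Nullary using (¬_; Dec)

record Graph (n : ℕ) : Set₁ where
  field
    Adj     : Fin n → Fin n → Set
    adj?    : ∀ x y → Dec (Adj x y)
    sym     : ∀ {x y} → Adj x y → Adj y x
    irrefl  : ∀ x → ¬ Adj x x
open Graph public

Coloring : ℕ → Set
Coloring n = Fin n → ℕ

Proper : ∀ {n} → Graph n → ℕ → Coloring n → Set
Proper G k f = (∀ x → 1 ≤ f x × f x ≤ k) × (∀ x y → Adj G x y → f x ≢ f y)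

Differ1 : ∀ {n} → Coloring n → Coloring n → Set
Differ1 {n} f g = Σ (Fin n) λ v → f v ≢ g v × (∀ w → w ≢ v → f w ≡ g w)

data Walk {n} (G : Graph n) (k : ℕ) : Coloring n → Coloring n → ℕ → Set where
  here : ∀ {f g} → Proper G k f → (∀ x → f x ≡ g x) → Walk G k f g 0
  step : ∀ {f h g m} → Proper G k f → Differ1 f h → Walk G k h g m → Walk G k f g (suc m)

DistLE : ∀ {n} → Graph n → ℕ → Coloring n → Coloring n → ℕ → Set
DistLE G k α β m = ∃[ ℓ ] (ℓ ≤ m × Walk G k α β ℓ)

-- f is the greedy coloring of G w.r.t. the ordering x_i = σ(i):
-- f(x_i) is the least positive integer not used on earlier neighbours of x_i.
IsGreedy : ∀ {n} → Graph n → Permutation′ n → Coloring n → Set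
IsGreedy {n} G σ f = ∀ (i : Fin n) →
    (1 ≤ f (σ ⟨$⟩ʳ i))
  × (∀ (j : Fin n) → j <ᶠ i → Adj G (σ ⟨$⟩ʳ i) (σ ⟨$⟩ʳ j) → f (σ ⟨$⟩ʳ j) ≢ f (σ ⟨$⟩ʳ i))
  × (∀ (c : ℕ) → 1 ≤ c → c < f (σ ⟨$⟩ʳ i) →
       ∃[ j ] (j <ᶠ i × Adj G (σ ⟨$⟩ʳ i) (σ ⟨$⟩ʳ j) × f (σ ⟨$⟩ʳ j) ≡ c))

UsesColors : ∀ {n} → Coloring n → ℕ → Set
UsesColors {n} f t = (∀ x → 1 ≤ f x × f x ≤ t) × (∀ c → 1 ≤ c → c ≤ t → ∃[ x ] (f x ≡ c))

IsGrundy : ∀ {n} → Graph n → ℕ → Set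
IsGrundy {n} G g =
    (∃[ σ ] ∃[ f ] (IsGreedy G σ f × UsesColors f g))
  × (∀ σ f t → IsGreedy G σ f → UsesColors f t → t ≤ g)

IsChromatic : ∀ {n} → Graph n → ℕ → Set
IsChromatic {n} G χ = (∃[ f ] Proper G χ f) × (∀ m f → Proper G m f → χ ≤ m)

Optimal : ∀ {n} → Graph n → ℕ → Coloring n → Set
Optimal {n} G χ β = ∃[ σ ] (IsGreedy G σ β × UsesColors β χ)

-- β is greedy with colours 1,…,χ, so every vertex sees all smaller β-colours (a Grundy colouring) and
-- χ ≤ χ_g(G) < k. From α we make the colouring agree with β on the classes c = 1, 2, …, χ in turn, each in
-- at most 2n recolourings. First, for a = 1, …, k, each vertex of colour a missing a smaller colour among its
-- neighbours is lowered to its least unseen colour; a vertex moves at most once, and the result is a Grundy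
-- colouring, which is greedy for an ordering by colour and so uses at most χ_g(G) colours, freeing colour k.
-- Because β is a Grundy colouring, vertices already agreeing with β below c are never moved. Then the
-- vertices coloured c but not by β are parked on k, and those that β colours c are moved to c (legal as β is
-- proper); again every vertex moves at most once.

module Submission where

open import Defs renaming (sym to Adj-sym; irrefl to Adj-irrefl)
open import Data.Nat using (ℕ; zero; suc; _≤_; _<_; _+_; _*_; z≤n; s≤s; _≟_; _<?_; _≤?_)
open import Data.Nat.Properties
open import Data.Fin as Fin using (Fin; toℕ; fromℕ<; punchOut) renaming (_<_ to _<ᶠ_)
open import Data.Fin.Properties as Fin using (pigeonhole; punchOut-injective; any?; toℕ-fromℕ<)
open import Data.Fin.Permutation using (Permutation′; _⟨$⟩ʳ_; _⟨$⟩ˡ_; permutation; inverseʳ; inverseˡ)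
open import Data.Product using (∃; ∃₂; _×_; _,_; proj₁; proj₂)
open import Data.Product.Relation.Binary.Lex.Strict
  using (×-Lex; ×-transitive; ×-irreflexive; ×-compare; ×-decidable)
open import Data.Sum using (_⊎_; inj₁; inj₂; [_,_]′)
open import Function using (_∘_; const)
open import Data.Unit using (tt)
open import Relation.Binary.Definitions using (tri<; tri≈; tri>)
open import Relation.Binary.PropositionalEquality
open import Relation.Nullary using (¬_; Dec; yes; no)
open import Relation.Nullary.Negation using (contradiction)
open import Relation.Nullary.Decidable using (_×-dec_; _⊎-dec_; ¬?; decidable-stable)
open import Data.List using (allFin)
open import Data.Vec.Functional using (updateAt)
open import Data.Vec.Functional.Properties using (updateAt-updates; updateAt-minimal)
open import Data.List.Extrema.Nat using (argmax; f[xs]≤f[argmax])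
open import Data.List.Membership.Propositional.Properties using (∈-allFin)
import Data.List.Relation.Unary.All as All
open import Data.Nat.Tactic.RingSolver using (solve-∀)

count : ∀ {n} {P : Fin n → Set} → (∀ i → Dec (P i)) → ℕ
count {zero}  P? = 0
count {suc n} P? with P? Fin.zero
... | yes _ = suc (count (P? ∘ Fin.suc))
... | no  _ = count (P? ∘ Fin.suc)

count≤n : ∀ {n} {P : Fin n → Set} (P? : ∀ i → Dec (P i)) → count P? ≤ n
count≤n {zero}  P? = z≤n
count≤n {suc n} P? with P? Fin.zero
... | yes _ = s≤s (count≤n (P? ∘ Fin.suc))
... | no  _ = m≤n⇒m≤1+n (count≤n (P? ∘ Fin.suc))

count-mono : ∀ {n} {P Q : Fin n → Set} (P? : ∀ i → Dec (P i)) (Q? : ∀ i → Dec (Q i)) →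
             (∀ i → P i → Q i) → count P? ≤ count Q?
count-mono {zero}  P? Q? P⊆Q = z≤n
count-mono {suc n} P? Q? P⊆Q with P? Fin.zero | Q? Fin.zero
... | yes _ | yes _  = s≤s (count-mono (P? ∘ Fin.suc) (Q? ∘ Fin.suc) (P⊆Q ∘ Fin.suc))
... | yes p | no ¬q  = contradiction (P⊆Q Fin.zero p) ¬q
... | no  _ | yes _  = m≤n⇒m≤1+n (count-mono (P? ∘ Fin.suc) (Q? ∘ Fin.suc) (P⊆Q ∘ Fin.suc))
... | no  _ | no  _  = count-mono (P? ∘ Fin.suc) (Q? ∘ Fin.suc) (P⊆Q ∘ Fin.suc)

count-strict : ∀ {n} {P Q : Fin n → Set} (P? : ∀ i → Dec (P i)) (Q? : ∀ i → Dec (Q i)) →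
               (∀ i → P i → Q i) → ∀ w → Q w → ¬ P w → count P? < count Q?
count-strict {suc n} P? Q? P⊆Q Fin.zero qw ¬pw with P? Fin.zero | Q? Fin.zero
... | yes p | _      = contradiction p ¬pw
... | no  _ | yes _  = s≤s (count-mono (P? ∘ Fin.suc) (Q? ∘ Fin.suc) (P⊆Q ∘ Fin.suc))
... | no  _ | no ¬q  = contradiction qw ¬q
count-strict {suc n} P? Q? P⊆Q (Fin.suc w) qw ¬pw with P? Fin.zero | Q? Fin.zero
... | yes _ | yes _  = s≤s (count-strict (P? ∘ Fin.suc) (Q? ∘ Fin.suc) (P⊆Q ∘ Fin.suc) w qw ¬pw)
... | yes p | no ¬q  = contradiction (P⊆Q Fin.zero p) ¬q
... | no  _ | yes _  = m≤n⇒m≤1+n (count-strict (P? ∘ Fin.suc) (Q? ∘ Fin.suc) (P⊆Q ∘ Fin.suc) w qw ¬pw)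
... | no  _ | no  _  = count-strict (P? ∘ Fin.suc) (Q? ∘ Fin.suc) (P⊆Q ∘ Fin.suc) w qw ¬pw

count<n : ∀ {n} {P : Fin n → Set} (P? : ∀ i → Dec (P i)) → ∀ w → ¬ P w → count P? < n
count<n {n} P? w ¬pw =
  <-≤-trans (count-strict P? (λ _ → yes tt) (λ _ _ → tt) w tt ¬pw) (count≤n {n} (λ _ → yes tt))

injective⇒surjective : ∀ {n} (h : Fin n → Fin n) → (∀ {x y} → h x ≡ h y → x ≡ y) →
                       ∀ i → ∃ λ x → h x ≡ i
injective⇒surjective {suc m} h h-inj i with any? (λ x → h x Fin.≟ i)
... | yes hit = hit
... | no miss with pigeonhole (n<1+n m) (λ x → punchOut (miss ∘ (x ,_) ∘ sym))
... | a , b , a<b , same =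
  contradiction (h-inj (punchOut-injective (miss ∘ (a ,_) ∘ sym) (miss ∘ (b ,_) ∘ sym) same)) (Fin.<⇒≢ a<b)

-- The backward map σ ⟨$⟩ˡ_ of the resulting permutation is h itself, definitionally.
injective⇒permutation : ∀ {n} (h : Fin n → Fin n) → (∀ {x y} → h x ≡ h y → x ≡ y) → Permutation′ n
injective⇒permutation {n} h h-inj = permutation preimage h (λ x → h-inj (section (h x))) section
  where
  preimage : Fin n → Fin n
  preimage i = proj₁ (injective⇒surjective h h-inj i)
  section : ∀ i → h (preimage i) ≡ i
  section i = proj₂ (injective⇒surjective h h-inj i)

module _ {n : ℕ} (key : Fin n → ℕ) where
  private
    _≺_ : Fin n → Fin n → Set
    x ≺ y = ×-Lex _≡_ _<_ _<ᶠ_ (key x , x) (key y , y)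

    _≺?_ : ∀ x y → Dec (x ≺ y)
    x ≺? y = ×-decidable _≟_ _<?_ Fin._<?_ (key x , x) (key y , y)

    ≺-trans : ∀ {x y z} → x ≺ y → y ≺ z → x ≺ z
    ≺-trans = ×-transitive {_≈₁_ = _≡_} {_<₁_ = _<_} {_<₂_ = _<ᶠ_}
                           isEquivalence (resp₂ _<_) <-trans Fin.<-trans

    ≺-irrefl : ∀ x → ¬ x ≺ x
    ≺-irrefl x = ×-irreflexive {_≈₁_ = _≡_} {_<₁_ = _<_} {_≈₂_ = _≡_} {_<₂_ = _<ᶠ_}
                               <-irrefl Fin.<-irrefl (refl , refl)

    rank : Fin n → ℕ
    rank x = count (_≺? x)

    rank-mono : ∀ {x y} → x ≺ y → rank x < rank y
    rank-mono {x} x≺y =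
      count-strict (_≺? x) (_≺? _) (λ z z≺x → ≺-trans z≺x x≺y) x x≺y (≺-irrefl x)

    rank-injective : ∀ {x y} → rank x ≡ rank y → x ≡ y
    rank-injective {x} {y} same with ×-compare sym <-cmp Fin.<-cmp (key x , x) (key y , y)
    ... | tri< x≺y _ _ = contradiction same (<⇒≢ (rank-mono x≺y))
    ... | tri≈ _ (_ , x≡y) _ = x≡y
    ... | tri> _ _ y≺x = contradiction (sym same) (<⇒≢ (rank-mono y≺x))

    position : Fin n → Fin n
    position x = fromℕ< (count<n (_≺? x) x (≺-irrefl x))

    toℕ-position : ∀ x → toℕ (position x) ≡ rank x
    toℕ-position x = toℕ-fromℕ< _

    position-injective : ∀ {x y} → position x ≡ position y → x ≡ y
    position-injective {x} {y} same =
      rank-injective (trans (sym (toℕ-position x)) (trans (cong toℕ same) (toℕ-position y)))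

  sortingPermutation : ∃ λ (σ : Permutation′ n) → ∀ x y → key x < key y → σ ⟨$⟩ˡ x <ᶠ σ ⟨$⟩ˡ y
  sortingPermutation = σ , sorted
    where
    σ : Permutation′ n
    σ = injective⇒permutation position position-injective
    sorted : ∀ x y → key x < key y → σ ⟨$⟩ˡ x <ᶠ σ ⟨$⟩ˡ y
    sorted x y kx<ky = subst₂ _<_ (sym (toℕ-position x)) (sym (toℕ-position y)) (rank-mono (inj₁ kx<ky))

leastFailure : ∀ {U : ℕ → Set} → (∀ c → Dec (U c)) → ∀ t →
               (∀ c → 1 ≤ c → c ≤ t → U c) ⊎
               ∃ λ m → 1 ≤ m × m ≤ t × ¬ U m × (∀ c → 1 ≤ c → c < m → U c)
leastFailure U? zero = inj₁ λ c 1≤c c≤0 → contradiction (≤-trans 1≤c c≤0) λ ()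
leastFailure U? (suc t) with leastFailure U? t
... | inj₂ (m , 1≤m , m≤t , ¬Um , below) = inj₂ (m , 1≤m , m≤n⇒m≤1+n m≤t , ¬Um , below)
... | inj₁ upTo-t with U? (suc t)
...   | yes Ut+1 =
  inj₁ λ c 1≤c c≤t+1 → [ upTo-t c 1≤c ∘ ≤-pred , (λ { refl → Ut+1 }) ]′ (m≤n⇒m<n∨m≡n c≤t+1)
...   | no ¬Ut+1 =
  inj₂ (suc t , s≤s z≤n , ≤-refl , ¬Ut+1 , λ c 1≤c c≤t → upTo-t c 1≤c (≤-pred c≤t))

module Colorings {n : ℕ} (G : Graph n) where

  Sees : Coloring n → Fin n → ℕ → Set
  Sees f x c = ∃ λ y → Adj G x y × f y ≡ c

  sees? : ∀ f x c → Dec (Sees f x c)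
  sees? f x c = any? (λ y → adj? G x y ×-dec (f y ≟ c))

  SeesLower : Coloring n → Fin n → Set
  SeesLower f x = ∀ c → 1 ≤ c → c < f x → Sees f x c

  IsGrundyColoring : Coloring n → Set
  IsGrundyColoring f = ∀ x → SeesLower f x

  NoMonochromaticEdge : Coloring n → Set
  NoMonochromaticEdge f = ∀ x y → Adj G x y → f x ≢ f y

  module _ {σ : Permutation′ n} {f : Coloring n} (greedy : IsGreedy G σ f) where

    greedy⇒noMonochromaticEdge : NoMonochromaticEdge f
    greedy⇒noMonochromaticEdge x y adj =
      subst₂ (λ u v → f u ≢ f v) (inverseʳ σ) (inverseʳ σ)
        (at (σ ⟨$⟩ˡ x) (σ ⟨$⟩ˡ y) (subst₂ (Adj G) (sym (inverseʳ σ)) (sym (inverseʳ σ)) adj))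
      where
      at : ∀ i j → Adj G (σ ⟨$⟩ʳ i) (σ ⟨$⟩ʳ j) → f (σ ⟨$⟩ʳ i) ≢ f (σ ⟨$⟩ʳ j)
      at i j adj with Fin.<-cmp i j
      ... | tri< i<j _ _ = proj₁ (proj₂ (greedy j)) i i<j (Adj-sym G adj)
      ... | tri≈ _ refl _ = contradiction adj (Adj-irrefl G _)
      ... | tri> _ _ j<i = proj₁ (proj₂ (greedy i)) j j<i adj ∘ sym

    greedy⇒grundyColoring : IsGrundyColoring f
    greedy⇒grundyColoring x = subst (SeesLower f) (inverseʳ σ) (at (σ ⟨$⟩ˡ x))
      where
      at : ∀ i → SeesLower f (σ ⟨$⟩ʳ i)
      at i c 1≤c c<fi with proj₂ (proj₂ (greedy i)) c 1≤c c<fi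
      ... | j , _ , adj , fj≡c = σ ⟨$⟩ʳ j , adj , fj≡c

  module _ {f : Coloring n} (positive : ∀ x → 1 ≤ f x) (noMono : NoMonochromaticEdge f)
           (grundyColoring : IsGrundyColoring f) where

    grundyColoring⇒greedy : ∃ λ σ → IsGreedy G σ f
    grundyColoring⇒greedy = σ , greedy
      where
      σ : Permutation′ n
      σ = proj₁ (sortingPermutation f)
      greedy : IsGreedy G σ f
      greedy i = positive _ , (λ j _ adj same → noMono _ _ adj (sym same)) , lower
        where
        lower : ∀ c → 1 ≤ c → c < f (σ ⟨$⟩ʳ i) →
                ∃ λ j → j <ᶠ i × Adj G (σ ⟨$⟩ʳ i) (σ ⟨$⟩ʳ j) × f (σ ⟨$⟩ʳ j) ≡ c
        lower c 1≤c c<fi with grundyColoring (σ ⟨$⟩ʳ i) c 1≤c c<fi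
        ... | y , adj , refl =
          σ ⟨$⟩ˡ y ,
          subst (σ ⟨$⟩ˡ y <ᶠ_) (inverseˡ σ) (proj₂ (sortingPermutation f) y (σ ⟨$⟩ʳ i) c<fi) ,
          subst (Adj G _) (sym (inverseʳ σ)) adj ,
          cong f (inverseʳ σ)

    grundyColoring⇒≤grundyNumber : ∀ {g} → IsGrundy G g → ∀ x → f x ≤ g
    grundyColoring⇒≤grundyNumber (_ , maximal) x =
      ≤-trans (below x)
              (maximal (proj₁ grundyColoring⇒greedy) f (f top) (proj₂ grundyColoring⇒greedy) (colors , used))
      where
      top : Fin n
      top = argmax f x (allFin n)
      below : ∀ y → f y ≤ f top
      below y = All.lookup (f[xs]≤f[argmax] x (allFin n)) (∈-allFin y)
      colors : ∀ y → 1 ≤ f y × f y ≤ f top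
      colors y = positive y , below y
      used : ∀ c → 1 ≤ c → c ≤ f top → ∃ λ y → f y ≡ c
      used c 1≤c c≤top with m≤n⇒m<n∨m≡n c≤top
      ... | inj₁ c<top = let (y , _ , fy≡c) = grundyColoring top c 1≤c c<top in y , fy≡c
      ... | inj₂ refl  = top , refl

module Reconfiguration {n : ℕ} (G : Graph n) (k : ℕ) where
  open Colorings G

  leastUnseen : ∀ {f} → Proper G k f → ∀ x →
                ∃ λ m → 1 ≤ m × m ≤ f x × ¬ Sees f x m × (∀ c → 1 ≤ c → c < m → Sees f x c)
  leastUnseen {f} (range , noMono) x with leastFailure (sees? f x) (f x)
  ... | inj₂ least = least
  ... | inj₁ seesAll with seesAll (f x) (proj₁ (range x)) ≤-refl
  ...   | y , adj , fy≡fx = contradiction (sym fy≡fx) (noMono x y adj)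

  recolor : Coloring n → Fin n → ℕ → Coloring n
  recolor f x m = updateAt f x (const m)

  module _ {f : Coloring n} {x : Fin n} {m : ℕ} where

    recolor-at : recolor f x m x ≡ m
    recolor-at = updateAt-updates x f

    recolor-elsewhere : ∀ {y} → y ≢ x → recolor f x m y ≡ f y
    recolor-elsewhere {y} = updateAt-minimal y x f

    recolor-differ1 : m ≢ f x → Differ1 f (recolor f x m)
    recolor-differ1 m≢fx =
      x , (λ fx≡f′x → m≢fx (sym (trans fx≡f′x recolor-at))) , λ _ → sym ∘ recolor-elsewhere

    recolor-proper : Proper G k f → 1 ≤ m → m ≤ k → ¬ Sees f x m → Proper G k (recolor f x m)
    recolor-proper (range , noMono) 1≤m m≤k unseen = range′ , noMono′
      where
      range′ : ∀ y → 1 ≤ recolor f x m y × recolor f x m y ≤ k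
      range′ y with y Fin.≟ x
      ... | yes refl = subst (λ c → 1 ≤ c × c ≤ k) (sym recolor-at) (1≤m , m≤k)
      ... | no y≢x = subst (λ c → 1 ≤ c × c ≤ k) (sym (recolor-elsewhere y≢x)) (range y)
      noMono′ : NoMonochromaticEdge (recolor f x m)
      noMono′ y z adj with y Fin.≟ x | z Fin.≟ x
      ... | yes refl | yes refl = contradiction adj (Adj-irrefl G y)
      ... | yes refl | no z≢x = λ same →
        unseen (z , adj , trans (sym (recolor-elsewhere z≢x)) (trans (sym same) recolor-at))
      ... | no y≢x | yes refl = λ same →
        unseen (y , Adj-sym G adj , trans (sym (recolor-elsewhere y≢x)) (trans same recolor-at))
      ... | no y≢x | no z≢x = λ same →
        noMono y z adj (trans (sym (recolor-elsewhere y≢x)) (trans same (recolor-elsewhere z≢x)))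

    seesLower-recolor-self : (∀ c → 1 ≤ c → c < m → Sees f x c) → SeesLower (recolor f x m) x
    seesLower-recolor-self below c 1≤c c<m with below c 1≤c (subst (c <_) recolor-at c<m)
    ... | y , adj , fy≡c = y , adj , trans (recolor-elsewhere (λ { refl → Adj-irrefl G x adj })) fy≡c

    seesLower-recolor-other : ∀ {y} → y ≢ x → f y ≤ f x → SeesLower f y → SeesLower (recolor f x m) y
    seesLower-recolor-other {y} y≢x fy≤fx seesLower c 1≤c c<f′y
      with c<fy ← subst (c <_) (recolor-elsewhere y≢x) c<f′y
      with seesLower c 1≤c c<fy
    ... | z , adj , fz≡c with z Fin.≟ x
    ...   | yes refl = contradiction (<-≤-trans c<fy fy≤fx) (<-irrefl (sym fz≡c))
    ...   | no z≢x = z , adj , trans (recolor-elsewhere z≢x) fz≡c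

  walk-≗-start : ∀ {f f′ g ℓ} → f ≗ f′ → Proper G k f′ → Walk G k f g ℓ → Walk G k f′ g ℓ
  walk-≗-start f≗f′ pf′ (here _ f≗g) = here pf′ (λ y → trans (sym (f≗f′ y)) (f≗g y))
  walk-≗-start f≗f′ pf′ (step _ (v , fv≢hv , same) w) =
    step pf′ (v , fv≢hv ∘ trans (f≗f′ v) , λ u u≢v → trans (sym (f≗f′ u)) (same u u≢v)) w

  walk-≗-end : ∀ {f g h ℓ} → Walk G k f g ℓ → g ≗ h → Walk G k f h ℓ
  walk-≗-end (here pf f≗g) g≗h = here pf (λ y → trans (f≗g y) (g≗h y))
  walk-≗-end (step pf d w) g≗h = step pf d (walk-≗-end w g≗h)

  walk-++ : ∀ {f g h a b} → Walk G k f g a → Walk G k g h b → Walk G k f h (a + b)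
  walk-++ (here pf f≗g) w = walk-≗-start (sym ∘ f≗g) pf w
  walk-++ (step pf d w) w′ = step pf d (walk-++ w w′)

  Reach : (Φ Ψ : Coloring n → ℕ) → (Coloring n → Set) → Coloring n → Set
  Reach Φ Ψ P f = ∃ λ f′ → Proper G k f′ × P f′ ×
                  ∃ λ ℓ → Walk G k f f′ ℓ × ℓ + Ψ f′ ≤ Φ f

  module _ {Φ Ψ : Coloring n → ℕ} {P : Coloring n → Set} where

    reach-refl : ∀ {f} → Proper G k f → P f → Ψ f ≤ Φ f → Reach Φ Ψ P f
    reach-refl {f} pf Pf Ψ≤Φ = f , pf , Pf , 0 , here pf (λ _ → refl) , Ψ≤Φ

    reach-trans : ∀ {Θ Q f} → Reach Φ Ψ P f → (∀ g → Proper G k g → P g → Reach Ψ Θ Q g) →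
                  Reach Φ Θ Q f
    reach-trans (g , pg , Pg , ℓ , w , paid) continue with continue g pg Pg
    ... | h , ph , Qh , ℓ′ , w′ , paid′ =
      h , ph , Qh , ℓ + ℓ′ , walk-++ w w′ ,
      ≤-trans (≤-reflexive (+-assoc ℓ ℓ′ _)) (≤-trans (+-monoʳ-≤ ℓ paid′) paid)

    reach-weaken : ∀ {Ψ′ f} → (∀ g → Ψ′ g ≤ Ψ g) → Reach Φ Ψ P f → Reach Φ Ψ′ P f
    reach-weaken Ψ′≤Ψ (g , pg , Pg , ℓ , w , paid) =
      g , pg , Pg , ℓ , w , ≤-trans (+-monoʳ-≤ ℓ (Ψ′≤Ψ g)) paid

    reach-recolor : ∀ {f x m} → Proper G k f → m ≢ f x → Φ (recolor f x m) < Φ f →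
                    Reach Φ Ψ P (recolor f x m) → Reach Φ Ψ P f
    reach-recolor pf m≢fx drop (g , pg , Pg , ℓ , w , paid) =
      g , pg , Pg , suc ℓ , step pf (recolor-differ1 m≢fx) w , ≤-trans (s≤s paid) drop

  Move : (Coloring n → Set) → (Coloring n → ℕ) → Coloring n → Set
  Move I Φ f = ∃₂ λ x m → m ≢ f x × Proper G k (recolor f x m) × I (recolor f x m) ×
                          Φ (recolor f x m) < Φ f

  descent : ∀ (I Goal : Coloring n → Set) (Φ : Coloring n → ℕ) →
            (∀ f → Proper G k f → I f → Goal f ⊎ Move I Φ f) →
            ∀ f → Proper G k f → I f → Reach Φ Φ Goal f
  descent I Goal Φ next f pf If = go (Φ f) f ≤-refl pf If
    where
    go : ∀ b f → Φ f ≤ b → Proper G k f → I f → Reach Φ Φ Goal f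
    go b f Φf≤b pf If with next f pf If
    ... | inj₁ goal = reach-refl {Φ} {Φ} {Goal} pf goal ≤-refl
    ... | inj₂ (x , m , m≢fx , pf′ , If′ , drop) with b
    ...   | zero   = contradiction (≤-trans drop Φf≤b) λ ()
    ...   | suc b′ =
      reach-recolor {Φ} {Φ} {Goal} pf m≢fx drop (go b′ _ (≤-pred (≤-trans drop Φf≤b)) pf′ If′)

  module _ {R : ℕ → Fin n → Set} (R? : ∀ c y → Dec (R c y)) where

    weight : Coloring n → ℕ
    weight f = count (λ y → R? (f y) y)

    weight-recolor< : ∀ {f x m} → R (f x) x → ¬ R m x → weight (recolor f x m) < weight f
    weight-recolor< {f} {x} {m} Rfx ¬Rm =
      count-strict _ _ unchanged x Rfx (¬Rm ∘ subst (λ c → R c x) recolor-at)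
      where
      unchanged : ∀ y → R (recolor f x m y) y → R (f y) y
      unchanged y with y Fin.≟ x
      ... | yes refl = λ _ → Rfx
      ... | no y≢x = subst (λ c → R c y) (recolor-elsewhere y≢x)

  Within : ℕ → (Coloring n → Set) → Coloring n → Set
  Within b P f = ∃ λ f′ → Proper G k f′ × P f′ × DistLE G k f f′ b

  reach⇒within : ∀ {Φ Ψ P f b} → Φ f ≤ b → Reach Φ Ψ P f → Within b P f
  reach⇒within Φf≤b (g , pg , Pg , ℓ , w , paid) =
    g , pg , Pg , ℓ , ≤-trans (m≤m+n ℓ _) (≤-trans paid Φf≤b) , w

  within-trans : ∀ {a b P Q f} → Within a P f → (∀ g → Proper G k g → P g → Within b Q g) →
                 Within (a + b) Q f
  within-trans (g , pg , Pg , ℓ , ℓ≤a , w) continue with continue g pg Pg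
  ... | h , ph , Qh , ℓ′ , ℓ′≤b , w′ =
    h , ph , Qh , ℓ + ℓ′ , +-mono-≤ ℓ≤a ℓ′≤b , walk-++ w w′

module Stage {n : ℕ} (G : Graph n) (k : ℕ) (β : Coloring n) where
  open Colorings G
  open Reconfiguration G k

  AgreesUpTo : ℕ → Coloring n → Set
  AgreesUpTo s f = ∀ y → β y ≤ s → f y ≡ β y

  module Greedify (βsees : IsGrundyColoring β) (s : ℕ) where

    agreesUpTo-recolor : ∀ {f x m} → AgreesUpTo s f → 1 ≤ m → m ≤ f x → ¬ Sees f x m →
                         AgreesUpTo s (recolor f x m)
    agreesUpTo-recolor {f} {x} {m} agree 1≤m m≤fx unseen y βy≤s with y Fin.≟ x
    ... | no y≢x = trans (recolor-elsewhere y≢x) (agree y βy≤s)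
    ... | yes refl with m≤n⇒m<n∨m≡n (subst (m ≤_) (agree y βy≤s) m≤fx)
    ...   | inj₂ m≡βx = trans recolor-at m≡βx
    ...   | inj₁ m<βx with βsees x m 1≤m m<βx
    ...     | z , adj , βz≡m = contradiction (z , adj , trans (agree z βz≤s) βz≡m) unseen
      where
      βz≤s : β z ≤ s
      βz≤s = ≤-trans (≤-reflexive βz≡m) (≤-trans (<⇒≤ m<βx) βy≤s)

    LowSeen : ℕ → Coloring n → Set
    LowSeen a f = ∀ y → f y < a → SeesLower f y

    Settled : ℕ → Coloring n → Set
    Settled a f = AgreesUpTo s f × LowSeen a f

    atLeast : ℕ → Coloring n → ℕ
    atLeast a = weight (λ c _ → a ≤? c)

    atLeast-antitone : ∀ a f → atLeast (suc a) f ≤ atLeast a f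
    atLeast-antitone a f = count-mono (λ y → suc a ≤? f y) (λ y → a ≤? f y) (λ _ → <⇒≤)

    module Round (a : ℕ) where

      lowerToLeastUnseen : ∀ {f x m} → Proper G k f → Settled a f → f x ≡ a → m < a →
                           1 ≤ m → ¬ Sees f x m → (∀ c → 1 ≤ c → c < m → Sees f x c) →
                           Move (Settled a) (atLeast a) f
      lowerToLeastUnseen {f} {x} {m} pf (agree , low) refl m<fx 1≤m unseen below =
        x , m , <⇒≢ m<fx , pf′ , (agreesUpTo-recolor agree 1≤m (<⇒≤ m<fx) unseen , low′) ,
        weight-recolor< (λ c _ → a ≤? c) ≤-refl (<⇒≱ m<fx)
        where
        pf′ : Proper G k (recolor f x m)
        pf′ = recolor-proper pf 1≤m (≤-trans (<⇒≤ m<fx) (proj₂ (proj₁ pf x))) unseen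
        low′ : LowSeen a (recolor f x m)
        low′ y f′y<a with y Fin.≟ x
        ... | yes refl = seesLower-recolor-self below
        ... | no y≢x = seesLower-recolor-other y≢x (<⇒≤ fy<a) (low y fy<a)
          where
          fy<a : f y < a
          fy<a = subst (_< a) (recolor-elsewhere y≢x) f′y<a

      next : ∀ f → Proper G k f → Settled a f → Settled (suc a) f ⊎ Move (Settled a) (atLeast a) f
      next f pf inv with any? (λ x → (f x ≟ a) ×-dec (proj₁ (leastUnseen pf x) <? a))
      ... | yes (x , fx≡a , m<a) with leastUnseen pf x
      ...   | m , 1≤m , _ , unseen , below = inj₂ (lowerToLeastUnseen pf inv fx≡a m<a 1≤m unseen below)
      next f pf (agree , low) | no none = inj₁ (agree , lowSeen)
        where
        lowSeen : LowSeen (suc a) f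
        lowSeen y fy≤a with m≤n⇒m<n∨m≡n (≤-pred fy≤a)
        ... | inj₁ fy<a = low y fy<a
        ... | inj₂ fy≡a with leastUnseen pf y | ≮⇒≥ (λ m<a → none (y , fy≡a , m<a))
        ...   | m , _ , _ , _ , below | a≤m =
          λ c 1≤c c<fy → below c 1≤c (<-≤-trans c<fy (subst (_≤ m) (sym fy≡a) a≤m))

      round : ∀ f → Proper G k f → Settled a f → Reach (atLeast a) (atLeast a) (Settled (suc a)) f
      round = descent (Settled a) (Settled (suc a)) (atLeast a) next

    rounds : ∀ r f → Proper G k f → AgreesUpTo s f →
             Reach (atLeast 1) (atLeast (suc r)) (Settled (suc r)) f
    rounds zero f pf agree =
      reach-refl {atLeast 1} {atLeast 1} {Settled 1} pf (agree , nothingBelow1) ≤-refl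
      where
      nothingBelow1 : LowSeen 1 f
      nothingBelow1 y fy<1 c 1≤c c<fy =
        contradiction (≤-trans 1≤c (≤-trans (<⇒≤ c<fy) (≤-pred fy<1))) λ ()
    rounds (suc r) f pf agree =
      reach-weaken {atLeast 1} {atLeast (suc r)} {Settled (suc (suc r))} (atLeast-antitone (suc r))
        (reach-trans {atLeast 1} {atLeast (suc r)} {Settled (suc r)}
                     (rounds r f pf agree) (Round.round (suc r)))

    greedify : ∀ f → Proper G k f → AgreesUpTo s f →
               Within n (λ f′ → AgreesUpTo s f′ × IsGrundyColoring f′) f
    greedify f pf agree with rounds k f pf agree
    ... | g , pg , (agree′ , low) , paid =
      reach⇒within {atLeast 1} {atLeast (suc k)} (count≤n _) (g , pg , (agree′ , allSeen) , paid)
      where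
      allSeen : IsGrundyColoring g
      allSeen y = low y (s≤s (proj₂ (proj₁ pg y)))

  module Align (βnoMono : NoMonochromaticEdge β) {g s : ℕ} (g<k : g < k) (s<g : s < g) where

    c : ℕ
    c = suc s

    c<k : c < k
    c<k = ≤-<-trans s<g g<k

    Mismatch : ℕ → Fin n → Set
    Mismatch v y = (v ≡ c × β y ≢ c) ⊎ (v ≢ c × β y ≡ c)

    mismatch? : ∀ v y → Dec (Mismatch v y)
    mismatch? v y = ((v ≟ c) ×-dec ¬? (β y ≟ c)) ⊎-dec (¬? (v ≟ c) ×-dec (β y ≟ c))

    mismatches : Coloring n → ℕ
    mismatches = weight mismatch?

    -- Colour k is free after greedification and parks the vertices evicted from colour c; the second
    -- component keeps each vertex still to be evicted (f = c, β ≠ c) free of k-coloured neighbours.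
    Inv : Coloring n → Set
    Inv f = AgreesUpTo s f × (∀ y z → Adj G y z → f y ≡ k → f z ≡ c → β z ≡ c)

    evict : ∀ {f x} → Proper G k f → Inv f → f x ≡ c → β x ≢ c → Move Inv mismatches f
    evict {f} {x} pf (agree , kSafe) fx≡c βx≢c =
      x , k , k≢fx , pf′ , (agree′ , kSafe′) ,
      weight-recolor< mismatch? {f} {x} {k} (inj₁ (fx≡c , βx≢c)) matched
      where
      k≢fx : k ≢ f x
      k≢fx k≡fx = <⇒≢ c<k (trans (sym fx≡c) (sym k≡fx))
      pf′ : Proper G k (recolor f x k)
      pf′ = recolor-proper {f} {x} {k} pf (≤-trans (s≤s z≤n) (<⇒≤ c<k)) ≤-refl unseen
        where
        unseen : ¬ Sees f x k
        unseen (y , adj , fy≡k) = βx≢c (kSafe y x (Adj-sym G adj) fy≡k fx≡c)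
      agree′ : AgreesUpTo s (recolor f x k)
      agree′ y βy≤s with y Fin.≟ x
      ... | yes refl = contradiction (subst (_≤ s) (trans (sym (agree y βy≤s)) fx≡c) βy≤s) (n≮n s)
      ... | no y≢x = trans (recolor-elsewhere y≢x) (agree y βy≤s)
      kSafe′ : ∀ y z → Adj G y z → recolor f x k y ≡ k → recolor f x k z ≡ c → β z ≡ c
      kSafe′ y z adj f′y≡k f′z≡c with z Fin.≟ x
      ... | yes refl = contradiction (trans (sym (recolor-at {f} {x} {k})) f′z≡c) (<⇒≢ c<k ∘ sym)
      ... | no z≢x with fz≡c ← trans (sym (recolor-elsewhere {f} {x} {k} z≢x)) f′z≡c with y Fin.≟ x
      ...   | yes refl = contradiction (trans fx≡c (sym fz≡c)) (proj₂ pf y z adj)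
      ...   | no y≢x = kSafe y z adj (trans (sym (recolor-elsewhere {f} {x} {k} y≢x)) f′y≡k) fz≡c
      matched : ¬ Mismatch k x
      matched (inj₁ (k≡c , _)) = <⇒≢ c<k (sym k≡c)
      matched (inj₂ (_ , βx≡c)) = βx≢c βx≡c

    settle : ∀ {f x} → Proper G k f → Inv f → (∀ y → f y ≡ c → β y ≡ c) → β x ≡ c → f x ≢ c →
             Move Inv mismatches f
    settle {f} {x} pf (agree , kSafe) onlyβ βx≡c fx≢c =
      x , c , fx≢c ∘ sym , pf′ , (agree′ , kSafe′) ,
      weight-recolor< mismatch? {f} {x} {c} (inj₂ (fx≢c , βx≡c)) matched
      where
      pf′ : Proper G k (recolor f x c)
      pf′ = recolor-proper {f} {x} {c} pf (s≤s z≤n) (<⇒≤ c<k) unseen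
        where
        unseen : ¬ Sees f x c
        unseen (y , adj , fy≡c) = βnoMono x y adj (trans βx≡c (sym (onlyβ y fy≡c)))
      agree′ : AgreesUpTo s (recolor f x c)
      agree′ y βy≤s with y Fin.≟ x
      ... | yes refl = contradiction (subst (_≤ s) βx≡c βy≤s) (n≮n s)
      ... | no y≢x = trans (recolor-elsewhere {f} {x} {c} y≢x) (agree y βy≤s)
      kSafe′ : ∀ y z → Adj G y z → recolor f x c y ≡ k → recolor f x c z ≡ c → β z ≡ c
      kSafe′ y z adj f′y≡k f′z≡c with y Fin.≟ x | z Fin.≟ x
      ... | yes refl | _ = contradiction (trans (sym (recolor-at {f} {x} {c})) f′y≡k) (<⇒≢ c<k)
      ... | no _ | yes refl = βx≡c
      ... | no y≢x | no z≢x = kSafe y z adj (trans (sym (recolor-elsewhere {f} {x} {c} y≢x)) f′y≡k)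
                                            (trans (sym (recolor-elsewhere {f} {x} {c} z≢x)) f′z≡c)
      matched : ¬ Mismatch c x
      matched (inj₁ (_ , βx≢c)) = βx≢c βx≡c
      matched (inj₂ (c≢c , _)) = c≢c refl

    next : ∀ f → Proper G k f → Inv f → AgreesUpTo c f ⊎ Move Inv mismatches f
    next f pf inv with any? (λ x → (f x ≟ c) ×-dec ¬? (β x ≟ c))
    ... | yes (x , fx≡c , βx≢c) = inj₂ (evict pf inv fx≡c βx≢c)
    ... | no noStray with any? (λ x → (β x ≟ c) ×-dec ¬? (f x ≟ c))
    ...   | yes (x , βx≡c , fx≢c) = inj₂ (settle pf inv onlyβ βx≡c fx≢c)
      where
      onlyβ : ∀ y → f y ≡ c → β y ≡ c
      onlyβ y fy≡c = decidable-stable (β y ≟ c) (λ βy≢c → noStray (y , fy≡c , βy≢c))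
    ...   | no noMissing = inj₁ agree′
      where
      agree′ : AgreesUpTo c f
      agree′ y βy≤c with m≤n⇒m<n∨m≡n βy≤c
      ... | inj₁ βy<c = proj₁ inv y (≤-pred βy<c)
      ... | inj₂ βy≡c =
        trans (decidable-stable (f y ≟ c) (λ fy≢c → noMissing (y , βy≡c , fy≢c))) (sym βy≡c)

    align : ∀ f → Proper G k f → AgreesUpTo s f → (∀ y → f y ≤ g) → Within n (AgreesUpTo c) f
    align f pf agree f≤g =
      reach⇒within {mismatches} {mismatches} (count≤n _)
        (descent Inv (AgreesUpTo c) mismatches next f pf (agree , noK))
      where
      noK : ∀ y z → Adj G y z → f y ≡ k → f z ≡ c → β z ≡ c
      noK y _ _ fy≡k _ = contradiction (subst (_≤ g) fy≡k (f≤g y)) (<⇒≱ g<k)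

  module _ (βpositive : ∀ y → 1 ≤ β y) (βsees : IsGrundyColoring β) (βnoMono : NoMonochromaticEdge β)
           {g : ℕ} (grundy : IsGrundy G g) (g<k : g < k) where

    advance : ∀ s → s < g → ∀ f → Proper G k f → AgreesUpTo s f → Within (n + n) (AgreesUpTo (suc s)) f
    advance s s<g f pf agree = within-trans (Greedify.greedify βsees s f pf agree) realign
      where
      realign : ∀ f′ → Proper G k f′ → AgreesUpTo s f′ × IsGrundyColoring f′ →
                Within n (AgreesUpTo (suc s)) f′
      realign f′ pf′ (agree′ , sees) =
        Align.align βnoMono g<k s<g f′ pf′ agree′
          (grundyColoring⇒≤grundyNumber (proj₁ ∘ proj₁ pf′) (proj₂ pf′) sees grundy)

    agreeUpTo : ∀ s → s ≤ g → ∀ α → Proper G k α → Within (s * (n + n)) (AgreesUpTo s) α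
    agreeUpTo zero _ α pα = α , pα , agreesUpTo0 , 0 , z≤n , here pα (λ _ → refl)
      where
      agreesUpTo0 : AgreesUpTo 0 α
      agreesUpTo0 y βy≤0 = contradiction (≤-trans (βpositive y) βy≤0) λ ()
    agreeUpTo (suc s) s<g α pα =
      subst (λ b → Within b (AgreesUpTo (suc s)) α) (+-comm (s * (n + n)) (n + n))
        (within-trans (agreeUpTo s (<⇒≤ s<g) α pα) (advance s s<g))

*-doubleʳ : ∀ a b → a * (b + b) ≡ 2 * a * b
*-doubleʳ = solve-∀

lemma2 : ∀ (n : ℕ) (G : Graph n) (k g χ : ℕ) →
         IsGrundy G g → IsChromatic G χ → g + 1 ≤ k →
         ∀ (α β : Coloring n) → Proper G k α → Optimal G χ β →
         DistLE G k α β (2 * χ * n)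
lemma2 n G k g χ grundy _ g+1≤k α β pα (σ , βgreedy , βuses@(βcolors , _)) = toβ reachAgreement
  where
  open Colorings G
  open Reconfiguration G k
  open Stage G k β
  g<k : g < k
  g<k = subst (_≤ k) (+-comm g 1) g+1≤k
  χ≤g : χ ≤ g
  χ≤g = proj₂ grundy σ β χ βgreedy βuses
  reachAgreement : Within (χ * (n + n)) (AgreesUpTo χ) α
  reachAgreement = agreeUpTo (proj₁ ∘ βcolors) (greedy⇒grundyColoring {σ} {β} βgreedy)
                             (greedy⇒noMonochromaticEdge {σ} {β} βgreedy)
                             grundy g<k χ χ≤g α pα
  toβ : Within (χ * (n + n)) (AgreesUpTo χ) α → DistLE G k α β (2 * χ * n)
  toβ (f , _ , agree , ℓ , ℓ≤ , w) =
    ℓ , ≤-trans ℓ≤ (≤-reflexive (*-doubleʳ χ n)) , walk-≗-end w (λ y → agree y (proj₂ (βcolors y)))
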